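{- For every set of formulas $\Gamma$ and formula $\varphi$: (1) $\Gamma\vdash_{\mathsf{NeL}+\{(\mathrm{DI})^{s}\}}\varphi$ iff $\Gamma\models_{\mathfrak{N}_{w}^{d}}\varphi$; (2) $\Gamma\vdash_{\mathsf{NeL}^{\mathrm{as}}+\{(\mathrm{DI})^{s}\}}\varphi$ iff $\Gamma\models_{\mathfrak{N}^{d}}\varphi$; (3) $\vdash_{\mathsf{NL}+\{(\mathrm{DI})\}}\varphi$ iff $\models_{\mathfrak{N}_{w}^{d}}\varphi$; (4) $\vdash_{\mathsf{NL}^{\mathrm{as}}+\{(\mathrm{DI})\}}\varphi$ iff $\models_{\mathfrak{N}^{d}}\varphi$.
   Context: Formulas: built from countably many variables with binary $\otimes,\circ$ and unary ${}^{*}$. Abbreviations (for formulas and algebra elements): $\varphi\Rightarrow\psi:=(\varphi\circ\psi^{*})^{*}$; $\varphi\Leftrightarrow\psi:=(\varphi\Rightarrow\psi)\otimes(\psi\Rightarrow\varphi)$; $\varphi\not\Leftrightarrow\psi:=(\varphi\Leftrightarrow\psi)^{*}$; $\varphi\not\Leftrightarrow\psi\not\Leftrightarrow\chi:=((\varphi\not\Leftrightarrow\psi)\otimes(\varphi\not\Leftrightarrow\chi))\otimes(\psi\not\Leftrightarrow\chi)$; $\varphi\oplus\psi:=(\varphi^{*}\otimes\psi^{*})^{*}$. Axiom schemes (A1) $\varphi\Rightarrow\varphi$; (A2) $(\varphi\circ\psi)\Rightarrow(\psi\circ\varphi)$; (A3) $\varphi\Rightarrow\varphi^{**}$; (A4)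 $(\varphi\Rightarrow\psi)\Rightarrow(\varphi\circ\psi)$; (A5) $(\varphi\otimes\psi)\Leftrightarrow(\psi\otimes\varphi)$; (A6) $((\varphi\otimes\psi)\Rightarrow\chi)\Rightarrow((\varphi\otimes\chi^{*})\Rightarrow\psi^{*})$; (A7) $(\varphi\not\Leftrightarrow\psi\not\Leftrightarrow\chi)\Rightarrow((\varphi\Rightarrow\psi)\Rightarrow((\psi\Rightarrow\chi)\Rightarrow(\varphi\Rightarrow\chi)))$; associativity schemes (AS1) $(\varphi\otimes\psi)\otimes\chi\Rightarrow\varphi\otimes(\psi\otimes\chi)$, (AS2) $\varphi\otimes(\psi\otimes\chi)\Rightarrow(\varphi\otimes\psi)\otimes\chi$. Rules: (MP) from $\varphi\Rightarrow\psi,\varphi$ infer $\psi$; (Adj) from $\varphi,\psi$ infer $\varphi\otimes\psi$; (Eq) from $\varphi\Leftrightarrow\psi$ and $\chi$ infer $\chi'$ ($\chi'$ from $\chi$ by replacing one or more occurrences of $\varphi$ by $\psi$); (CE) from $\varphi\otimes\psi$ infer $\varphi$; (DI) from $\varphi$ infer $\varphi\oplus\psi$. $\mathsf{NeL}+\{(\mathrm{DI})^{s}\}$: consequence relation of derivations from premises and instances of (A1)–(A7) using all five rules without restriction; $\mathsf{NeL}^{\mathrm{as}}+\{(\mathrm{DI})^{s}\}$ adds (AS1),(AS2). $\mathsf{NL}+\{(\mathrm{DI})\}$: theorems generated from instances of (A1)–(A7) by the five rules applied to theorems only; $\mathsf{NL}^{\mathrm{as}}+\{(\mathrm{DI})\}$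 adds (AS1),(AS2). A weak $\mathcal{N}$-algebra is $\mathbf A=(A,\otimes,\circ,{}^{*})$ with $\otimes,\circ$ commutative, $x^{**}=x$, $(x\otimes y)\circ z=(x\otimes z)\circ y$; an $\mathcal N$-algebra additionally has $\otimes$ associative. With distinct $\mathsf t,\mathsf f\notin A$, $\overline A=A\cup\{\mathsf t,\mathsf f\}$, an $\mathfrak{N}_{w}$-model is $(\mathbf A,\perp,\{\mathsf t,\mathsf f\})$, $\mathbf A$ a weak $\mathcal N$-algebra, $\perp\subseteq\overline A\times\overline A$, with for all $x,y,z\in A$: (a) $x\perp x^{*}$; (b) $x\perp y^{*}$ and $y\perp x^{*}$ imply $x=y$; (c) $x\perp y$ iff $x\circ y\perp\mathsf t$; (d) $x\perp\mathsf t$ iff $x^{*}\perp\mathsf f$; (e) $x\perp\mathsf f$ and $y\perp\mathsf f$ iff $x\otimes y\perp\mathsf f$; (f) $(x\circ y^{*})^{*}\perp(x\circ y)^{*}$; (g) $x\perp y$ and $x\perp\mathsf f$ imply $y\perp\mathsf t$; (h) $x\not\Leftrightarrow y\not\Leftrightarrow z\perp((x\Rightarrow y)\Rightarrow((y\Rightarrow z)\Rightarrow(x\Rightarrow z)))^{*}$. $\mathfrak{N}_{w}^{d}$ is the class of $\mathfrak{N}_{w}$-models satisfying: $x\perp\mathsf f$ implies $x\oplus y\perp\mathsf f$ for all $x,y\in A$; $\mathfrak{N}^{d}$ is its subclass with $\mathbf A$ an $\mathcal N$-algebra. $F_{\perp}=\{a:a\perp\mathsf f\}$. $\Gamma\models_{\mathcal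 K}\varphi$ iff there is a finite $\Gamma'\subseteq\Gamma$ such that for every model in $\mathcal K$ and every homomorphism $h$ from formulas to $\mathbf A$, $h(\Gamma')\subseteq F_{\perp}$ implies $h(\varphi)\in F_{\perp}$; $\models_{\mathcal K}\varphi$ iff $h(\varphi)\perp\mathsf f$ for all models in $\mathcal K$ and all $h$. -}

module Defs where

open import Data.Nat using (ℕ)
open import Data.Empty using (⊥)
open import Data.Unit using (⊤)
open import Data.Product using (Σ; _×_)
open import Data.List using (List)
open import Data.List.Relation.Unary.All using (All)
open import Relation.Binary.Structures using (IsEquivalence)

infixl 7 _⊗_
infixl 6 _∘_
infix 8 _*

data Formula : Set where
  var : ℕ → Formula
  _⊗_ : Formula → Formula → Formula
  _∘_ : Formula → Formula → Formula
  _*  : Formula → Formula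

infixr 4 _⇒_
infix 3 _⟺_ _⇎_
infixl 5 _⊕_

_⇒_ : Formula → Formula → Formula
φ ⇒ ψ = (φ ∘ ψ *) *

_⟺_ : Formula → Formula → Formula
φ ⟺ ψ = (φ ⇒ ψ) ⊗ (ψ ⇒ φ)

_⇎_ : Formula → Formula → Formula
φ ⇎ ψ = (φ ⟺ ψ) *

neq3 : Formula → Formula → Formula → Formula
neq3 φ ψ χ = ((φ ⇎ ψ) ⊗ (φ ⇎ χ)) ⊗ (ψ ⇎ χ)

_⊕_ : Formula → Formula → Formula
φ ⊕ ψ = ((φ *) ⊗ (ψ *)) *

FSet : Set₁
FSet = Formula → Set

-- Replacement: Rep φ ψ χ χ' : χ' arises from χ by replacing zero or more
-- occurrences of φ by ψ;  Rep⁺ φ ψ χ χ' : one or more occurrences.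

data Rep (φ ψ : Formula) : Formula → Formula → Set where
  rep-here : Rep φ ψ φ ψ
  rep-var  : ∀ n → Rep φ ψ (var n) (var n)
  rep-⊗    : ∀ {a a' b b'} → Rep φ ψ a a' → Rep φ ψ b b' → Rep φ ψ (a ⊗ b) (a' ⊗ b')
  rep-∘    : ∀ {a a' b b'} → Rep φ ψ a a' → Rep φ ψ b b' → Rep φ ψ (a ∘ b) (a' ∘ b')
  rep-*    : ∀ {a a'} → Rep φ ψ a a' → Rep φ ψ (a *) (a' *)

data Rep⁺ (φ ψ : Formula) : Formula → Formula → Set where
  rep⁺-here : Rep⁺ φ ψ φ ψ
  rep⁺-⊗ˡ   : ∀ {a a' b b'} → Rep⁺ φ ψ a a' → Rep φ ψ b b' → Rep⁺ φ ψ (a ⊗ b) (a' ⊗ b')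
  rep⁺-⊗ʳ   : ∀ {a a' b b'} → Rep φ ψ a a' → Rep⁺ φ ψ b b' → Rep⁺ φ ψ (a ⊗ b) (a' ⊗ b')
  rep⁺-∘ˡ   : ∀ {a a' b b'} → Rep⁺ φ ψ a a' → Rep φ ψ b b' → Rep⁺ φ ψ (a ∘ b) (a' ∘ b')
  rep⁺-∘ʳ   : ∀ {a a' b b'} → Rep φ ψ a a' → Rep⁺ φ ψ b b' → Rep⁺ φ ψ (a ∘ b) (a' ∘ b')
  rep⁺-*    : ∀ {a a'} → Rep⁺ φ ψ a a' → Rep⁺ φ ψ (a *) (a' *)

data Variant : Set where
  weak assoc : Variant

data Axiom : Variant → Formula → Set where
  A1 : ∀ {v} φ → Axiom v (φ ⇒ φ)
  A2 : ∀ {v} φ ψ → Axiom v ((φ ∘ ψ) ⇒ (ψ ∘ φ))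
  A3 : ∀ {v} φ → Axiom v (φ ⇒ φ * *)
  A4 : ∀ {v} φ ψ → Axiom v ((φ ⇒ ψ) ⇒ (φ ∘ ψ))
  A5 : ∀ {v} φ ψ → Axiom v ((φ ⊗ ψ) ⟺ (ψ ⊗ φ))
  A6 : ∀ {v} φ ψ χ → Axiom v (((φ ⊗ ψ) ⇒ χ) ⇒ ((φ ⊗ (χ *)) ⇒ (ψ *)))
  A7 : ∀ {v} φ ψ χ →
       Axiom v (neq3 φ ψ χ ⇒ ((φ ⇒ ψ) ⇒ ((ψ ⇒ χ) ⇒ (φ ⇒ χ))))
  AS1 : ∀ φ ψ χ → Axiom assoc (((φ ⊗ ψ) ⊗ χ) ⇒ (φ ⊗ (ψ ⊗ χ)))
  AS2 : ∀ φ ψ χ → Axiom assoc ((φ ⊗ (ψ ⊗ χ)) ⇒ ((φ ⊗ ψ) ⊗ χ))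

-- Derivations from premises Γ with rules MP, Adj, Eq, CE, DI applied freely.
-- Deriv weak  Γ φ  is  Γ ⊢_{NeL + {(DI)^s}} φ,
-- Deriv assoc Γ φ  is  Γ ⊢_{NeL^as + {(DI)^s}} φ.
data Deriv (v : Variant) (Γ : FSet) : Formula → Set where
  prem : ∀ {φ} → Γ φ → Deriv v Γ φ
  ax   : ∀ {φ} → Axiom v φ → Deriv v Γ φ
  mp   : ∀ {φ ψ} → Deriv v Γ (φ ⇒ ψ) → Deriv v Γ φ → Deriv v Γ ψ
  adj  : ∀ {φ ψ} → Deriv v Γ φ → Deriv v Γ ψ → Deriv v Γ (φ ⊗ ψ)
  eq   : ∀ {φ ψ χ χ'} → Deriv v Γ (φ ⟺ ψ) → Deriv v Γ χ → Rep⁺ φ ψ χ χ' →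
         Deriv v Γ χ'
  ce   : ∀ {φ ψ} → Deriv v Γ (φ ⊗ ψ) → Deriv v Γ φ
  di   : ∀ {φ} ψ → Deriv v Γ φ → Deriv v Γ (φ ⊕ ψ)

-- Theorems of NL + {(DI)} (v = weak) and NL^as + {(DI)} (v = assoc):
-- generated from axiom instances by the five rules applied to theorems only,
-- i.e. derivations with no premises.
data Thm (v : Variant) : Formula → Set where
  ax   : ∀ {φ} → Axiom v φ → Thm v φ
  mp   : ∀ {φ ψ} → Thm v (φ ⇒ ψ) → Thm v φ → Thm v ψ
  adj  : ∀ {φ ψ} → Thm v φ → Thm v ψ → Thm v (φ ⊗ ψ)
  eq   : ∀ {φ ψ χ χ'} → Thm v (φ ⟺ ψ) → Thm v χ → Rep⁺ φ ψ χ χ' → Thm v χ'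
  ce   : ∀ {φ ψ} → Thm v (φ ⊗ ψ) → Thm v φ
  di   : ∀ {φ} ψ → Thm v φ → Thm v (φ ⊕ ψ)

-- Weak N-algebras (carrier given as a setoid)

record WeakNAlg : Set₁ where
  infixl 7 _⊗ₐ_
  infixl 6 _∘ₐ_
  infix 8 _*ₐ
  field
    Carrier : Set
    _≈_     : Carrier → Carrier → Set
    isEquivalence : IsEquivalence _≈_
    _⊗ₐ_ : Carrier → Carrier → Carrier
    _∘ₐ_ : Carrier → Carrier → Carrier
    _*ₐ  : Carrier → Carrier
    ⊗-cong : ∀ {x x' y y'} → x ≈ x' → y ≈ y' → (x ⊗ₐ y) ≈ (x' ⊗ₐ y')
    ∘-cong : ∀ {x x' y y'} → x ≈ x' → y ≈ y' → (x ∘ₐ y) ≈ (x' ∘ₐ y')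
    *-cong : ∀ {x x'} → x ≈ x' → (x *ₐ) ≈ (x' *ₐ)
    ⊗-comm : ∀ x y → (x ⊗ₐ y) ≈ (y ⊗ₐ x)
    ∘-comm : ∀ x y → (x ∘ₐ y) ≈ (y ∘ₐ x)
    *-invol : ∀ x → (x *ₐ *ₐ) ≈ x
    ⊗∘-exch : ∀ x y z → ((x ⊗ₐ y) ∘ₐ z) ≈ ((x ⊗ₐ z) ∘ₐ y)

  infixr 4 _⇒ₐ_
  infix 3 _⟺ₐ_ _⇎ₐ_
  infixl 5 _⊕ₐ_

  _⇒ₐ_ : Carrier → Carrier → Carrier
  x ⇒ₐ y = (x ∘ₐ (y *ₐ)) *ₐ

  _⟺ₐ_ : Carrier → Carrier → Carrier
  x ⟺ₐ y = (x ⇒ₐ y) ⊗ₐ (y ⇒ₐ x)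

  _⇎ₐ_ : Carrier → Carrier → Carrier
  x ⇎ₐ y = (x ⟺ₐ y) *ₐ

  neq3ₐ : Carrier → Carrier → Carrier → Carrier
  neq3ₐ x y z = ((x ⇎ₐ y) ⊗ₐ (x ⇎ₐ z)) ⊗ₐ (y ⇎ₐ z)

  _⊕ₐ_ : Carrier → Carrier → Carrier
  x ⊕ₐ y = ((x *ₐ) ⊗ₐ (y *ₐ)) *ₐ

IsNAlg : WeakNAlg → Set
IsNAlg A = ∀ x y z → ((x ⊗ₐ y) ⊗ₐ z) ≈ (x ⊗ₐ (y ⊗ₐ z))
  where open WeakNAlg A

data Ext (X : Set) : Set where
  el : X → Ext X
  t  : Ext X
  f  : Ext X

data ExtEq {X : Set} (_≈_ : X → X → Set) : Ext X → Ext X → Set where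
  el≈ : ∀ {x y} → x ≈ y → ExtEq _≈_ (el x) (el y)
  t≈  : ExtEq _≈_ t t
  f≈  : ExtEq _≈_ f f

record NwModel : Set₁ where
  field
    alg : WeakNAlg
  open WeakNAlg alg
  field
    _⟂_ : Ext Carrier → Ext Carrier → Set
    ⟂-resp : ∀ {a b c d} → ExtEq _≈_ a c → ExtEq _≈_ b d → a ⟂ b → c ⟂ d
    c-a : ∀ x → el x ⟂ el (x *ₐ)
    c-b : ∀ x y → el x ⟂ el (y *ₐ) → el y ⟂ el (x *ₐ) → x ≈ y
    c-c₁ : ∀ x y → el x ⟂ el y → el (x ∘ₐ y) ⟂ t
    c-c₂ : ∀ x y → el (x ∘ₐ y) ⟂ t → el x ⟂ el y
    c-d₁ : ∀ x → el x ⟂ t → el (x *ₐ) ⟂ f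
    c-d₂ : ∀ x → el (x *ₐ) ⟂ f → el x ⟂ t
    c-e₁ : ∀ x y → el x ⟂ f → el y ⟂ f → el (x ⊗ₐ y) ⟂ f
    c-e₂ : ∀ x y → el (x ⊗ₐ y) ⟂ f → (el x ⟂ f) × (el y ⟂ f)
    c-f : ∀ x y → el ((x ∘ₐ (y *ₐ)) *ₐ) ⟂ el ((x ∘ₐ y) *ₐ)
    c-g : ∀ x y → el x ⟂ el y → el x ⟂ f → el y ⟂ t
    c-h : ∀ x y z →
          el (neq3ₐ x y z) ⟂ el (((x ⇒ₐ y) ⇒ₐ ((y ⇒ₐ z) ⇒ₐ (x ⇒ₐ z))) *ₐ)

  F⟂ : Carrier → Set
  F⟂ a = el a ⟂ f

-- membership in N_w^d (v = weak) resp. N^d (v = assoc)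
InClass : Variant → NwModel → Set
InClass v M =
  (∀ x y → F⟂ x → F⟂ (x ⊕ₐ y)) × AssocIf v
  where
    open NwModel M
    open WeakNAlg alg
    AssocIf : Variant → Set
    AssocIf weak  = ⊤
    AssocIf assoc = IsNAlg alg

record Hom (A : WeakNAlg) : Set where
  open WeakNAlg A
  field
    h   : Formula → Carrier
    h-⊗ : ∀ φ ψ → h (φ ⊗ ψ) ≈ (h φ ⊗ₐ h ψ)
    h-∘ : ∀ φ ψ → h (φ ∘ ψ) ≈ (h φ ∘ₐ h ψ)
    h-* : ∀ φ → h (φ *) ≈ (h φ *ₐ)

Consequence : Variant → FSet → Formula → Set₁
Consequence v Γ φ =
  Σ (List Formula) λ Γ' → All Γ Γ' ×
    ((M : NwModel) → InClass v M → (H : Hom (NwModel.alg M)) →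
      All (λ ψ → NwModel.F⟂ M (Hom.h H ψ)) Γ' → NwModel.F⟂ M (Hom.h H φ))

Valid : Variant → Formula → Set₁
Valid v φ = (M : NwModel) → InClass v M → (H : Hom (NwModel.alg M)) →
  NwModel.F⟂ M (Hom.h H φ)

-- Soundness: every axiom instance lands in F⟂ and every rule preserves F⟂, each
-- by one of the frame conditions (a)–(h); (Eq) is sound because (e) and (b) turn
-- an equivalence in F⟂ into an equality in the algebra.  Completeness: the
-- Lindenbaum model over Γ has formulas as elements, provable equivalence from Γ
-- as equality, and x ⟂ y, x ⟂ t, x ⟂ f meaning that Γ derives (x ∘ y)*, x*, x
-- respectively, so F⟂ is exactly the set of consequences of Γ and the identity
-- valuation witnesses every non-consequence.  The finite Γ' required by ⊨ comes
-- from the finitely many premises a derivation uses.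
module Submission where

open import Defs
open import Data.Product using (_×_)
open import Function.Bundles using (_⇔_)

open import Data.Nat using (ℕ)
open import Data.Product using (Σ-syntax; _,_; proj₁; proj₂)
open import Data.Sum using (_⊎_; inj₁; inj₂)
open import Data.Empty using (⊥)
open import Data.Unit using (tt)
open import Data.List using (List; []; [_]; _++_)
open import Data.List.Relation.Unary.All as All using (All; []; _∷_)
open import Data.List.Relation.Unary.All.Properties using (++⁺)
open import Data.List.Relation.Unary.Any using (here)
open import Data.List.Membership.Propositional using (_∈_)
open import Data.List.Membership.Propositional.Properties using (∈-++⁺ˡ; ∈-++⁺ʳ)
open import Relation.Binary.PropositionalEquality using (_≡_; refl)
open import Relation.Binary.Structures using (IsEquivalence)
open import Relation.Unary using (∅; _⊆_)
open import Function.Bundles using (mk⇔)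

private
  variable
    v : Variant
    Γ Δ : FSet
    φ ψ χ χ' : Formula

Rep-refl : ∀ χ → Rep φ ψ χ χ
Rep-refl (var n) = rep-var n
Rep-refl (a ⊗ b) = rep-⊗ (Rep-refl a) (Rep-refl b)
Rep-refl (a ∘ b) = rep-∘ (Rep-refl a) (Rep-refl b)
Rep-refl (a *)   = rep-* (Rep-refl a)

Rep⁺⇒Rep : Rep⁺ φ ψ χ χ' → Rep φ ψ χ χ'
Rep⁺⇒Rep rep⁺-here     = rep-here
Rep⁺⇒Rep (rep⁺-⊗ˡ p q) = rep-⊗ (Rep⁺⇒Rep p) q
Rep⁺⇒Rep (rep⁺-⊗ʳ p q) = rep-⊗ p (Rep⁺⇒Rep q)
Rep⁺⇒Rep (rep⁺-∘ˡ p q) = rep-∘ (Rep⁺⇒Rep p) q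
Rep⁺⇒Rep (rep⁺-∘ʳ p q) = rep-∘ p (Rep⁺⇒Rep q)
Rep⁺⇒Rep (rep⁺-* p)    = rep-* (Rep⁺⇒Rep p)

Rep⇒≡⊎Rep⁺ : Rep φ ψ χ χ' → χ ≡ χ' ⊎ Rep⁺ φ ψ χ χ'
Rep⇒≡⊎Rep⁺ rep-here    = inj₂ rep⁺-here
Rep⇒≡⊎Rep⁺ (rep-var n) = inj₁ refl
Rep⇒≡⊎Rep⁺ (rep-⊗ p q) with Rep⇒≡⊎Rep⁺ p | Rep⇒≡⊎Rep⁺ q
... | inj₂ p⁺   | _         = inj₂ (rep⁺-⊗ˡ p⁺ q)
... | inj₁ refl | inj₂ q⁺   = inj₂ (rep⁺-⊗ʳ p q⁺)
... | inj₁ refl | inj₁ refl = inj₁ refl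
Rep⇒≡⊎Rep⁺ (rep-∘ p q) with Rep⇒≡⊎Rep⁺ p | Rep⇒≡⊎Rep⁺ q
... | inj₂ p⁺   | _         = inj₂ (rep⁺-∘ˡ p⁺ q)
... | inj₁ refl | inj₂ q⁺   = inj₂ (rep⁺-∘ʳ p q⁺)
... | inj₁ refl | inj₁ refl = inj₁ refl
Rep⇒≡⊎Rep⁺ (rep-* p) with Rep⇒≡⊎Rep⁺ p
... | inj₂ p⁺   = inj₂ (rep⁺-* p⁺)
... | inj₁ refl = inj₁ refl

Deriv-mono : Γ ⊆ Δ → Deriv v Γ φ → Deriv v Δ φ
Deriv-mono Γ⊆Δ (prem p)   = prem (Γ⊆Δ p)
Deriv-mono Γ⊆Δ (ax a)     = ax a
Deriv-mono Γ⊆Δ (mp d e)   = mp (Deriv-mono Γ⊆Δ d) (Deriv-mono Γ⊆Δ e)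
Deriv-mono Γ⊆Δ (adj d e)  = adj (Deriv-mono Γ⊆Δ d) (Deriv-mono Γ⊆Δ e)
Deriv-mono Γ⊆Δ (eq d e r) = eq (Deriv-mono Γ⊆Δ d) (Deriv-mono Γ⊆Δ e) r
Deriv-mono Γ⊆Δ (ce d)     = ce (Deriv-mono Γ⊆Δ d)
Deriv-mono Γ⊆Δ (di ψ d)   = di ψ (Deriv-mono Γ⊆Δ d)

DerivFromFinite : Variant → FSet → Formula → Set
DerivFromFinite v Γ φ = Σ[ Γ' ∈ List Formula ] All Γ Γ' × Deriv v (_∈ Γ') φ

DerivFromFinite-map : (∀ {Δ} → Deriv v Δ φ → Deriv v Δ ψ) →
  DerivFromFinite v Γ φ → DerivFromFinite v Γ ψ
DerivFromFinite-map rule (Γ' , Γ'⊆Γ , d) = Γ' , Γ'⊆Γ , rule d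

DerivFromFinite-zipWith : (∀ {Δ} → Deriv v Δ φ → Deriv v Δ ψ → Deriv v Δ χ) →
  DerivFromFinite v Γ φ → DerivFromFinite v Γ ψ → DerivFromFinite v Γ χ
DerivFromFinite-zipWith rule (Γ₁ , Γ₁⊆Γ , d₁) (Γ₂ , Γ₂⊆Γ , d₂) =
  Γ₁ ++ Γ₂ , ++⁺ Γ₁⊆Γ Γ₂⊆Γ ,
  rule (Deriv-mono ∈-++⁺ˡ d₁) (Deriv-mono (∈-++⁺ʳ Γ₁) d₂)

Deriv-compact : Deriv v Γ φ → DerivFromFinite v Γ φ
Deriv-compact (prem p)   = [ _ ] , p ∷ [] , prem (here refl)
Deriv-compact (ax a)     = [] , [] , ax a
Deriv-compact (mp d e)   = DerivFromFinite-zipWith mp (Deriv-compact d) (Deriv-compact e)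
Deriv-compact (adj d e)  = DerivFromFinite-zipWith adj (Deriv-compact d) (Deriv-compact e)
Deriv-compact (eq d e r) = DerivFromFinite-zipWith (λ d' e' → eq d' e' r) (Deriv-compact d) (Deriv-compact e)
Deriv-compact (ce d)     = DerivFromFinite-map ce (Deriv-compact d)
Deriv-compact (di ψ d)   = DerivFromFinite-map (di ψ) (Deriv-compact d)

Thm⇒Deriv∅ : Thm v φ → Deriv v ∅ φ
Thm⇒Deriv∅ (ax a)     = ax a
Thm⇒Deriv∅ (mp d e)   = mp (Thm⇒Deriv∅ d) (Thm⇒Deriv∅ e)
Thm⇒Deriv∅ (adj d e)  = adj (Thm⇒Deriv∅ d) (Thm⇒Deriv∅ e)
Thm⇒Deriv∅ (eq d e r) = eq (Thm⇒Deriv∅ d) (Thm⇒Deriv∅ e) r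
Thm⇒Deriv∅ (ce d)     = ce (Thm⇒Deriv∅ d)
Thm⇒Deriv∅ (di ψ d)   = di ψ (Thm⇒Deriv∅ d)

Deriv∅⇒Thm : Deriv v ∅ φ → Thm v φ
Deriv∅⇒Thm (ax a)     = ax a
Deriv∅⇒Thm (mp d e)   = mp (Deriv∅⇒Thm d) (Deriv∅⇒Thm e)
Deriv∅⇒Thm (adj d e)  = adj (Deriv∅⇒Thm d) (Deriv∅⇒Thm e)
Deriv∅⇒Thm (eq d e r) = eq (Deriv∅⇒Thm d) (Deriv∅⇒Thm e) r
Deriv∅⇒Thm (ce d)     = ce (Deriv∅⇒Thm d)
Deriv∅⇒Thm (di ψ d)   = di ψ (Deriv∅⇒Thm d)

_⊨[_]_ : FSet → Variant → Formula → Set₁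
Γ ⊨[ v ] φ = (M : NwModel) → InClass v M → (H : Hom (NwModel.alg M)) →
  (∀ {ψ} → Γ ψ → NwModel.F⟂ M (Hom.h H ψ)) → NwModel.F⟂ M (Hom.h H φ)

module ModelProperties (M : NwModel) where
  open NwModel M
  open WeakNAlg alg
  open IsEquivalence isEquivalence using ()
    renaming (refl to ≈-refl; sym to ≈-sym; trans to ≈-trans)

  F⟂-resp : ∀ {a b} → a ≈ b → F⟂ a → F⟂ b
  F⟂-resp a≈b = ⟂-resp (el≈ a≈b) f≈

  ⟂*⇒F⟂-⇒ : ∀ {a b} → el a ⟂ el (b *ₐ) → F⟂ (a ⇒ₐ b)
  ⟂*⇒F⟂-⇒ a⟂b* = c-d₁ _ (c-c₁ _ _ a⟂b*)

  F⟂-⇒⇒⟂* : ∀ {a b} → F⟂ (a ⇒ₐ b) → el a ⟂ el (b *ₐ)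
  F⟂-⇒⇒⟂* a⇒b = c-c₂ _ _ (c-d₂ _ a⇒b)

  ≈⇒F⟂-⇒ : ∀ {a b} → a ≈ b → F⟂ (a ⇒ₐ b)
  ≈⇒F⟂-⇒ a≈b = ⟂*⇒F⟂-⇒ (⟂-resp (el≈ ≈-refl) (el≈ (*-cong a≈b)) (c-a _))

  F⟂-mp : ∀ {a b} → F⟂ (a ⇒ₐ b) → F⟂ a → F⟂ b
  F⟂-mp a⇒b a = F⟂-resp (*-invol _) (c-d₁ _ (c-g _ _ (F⟂-⇒⇒⟂* a⇒b) a))

  F⟂-⟺⇒≈ : ∀ {a b} → F⟂ (a ⟺ₐ b) → a ≈ b
  F⟂-⟺⇒≈ a⟺b with c-e₂ _ _ a⟺b
  ... | a⇒b , b⇒a = c-b _ _ (F⟂-⇒⇒⟂* a⇒b) (F⟂-⇒⇒⟂* b⇒a)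

  ⟦_⟧ : Formula → (ℕ → Carrier) → Carrier
  ⟦ var n ⟧ ρ = ρ n
  ⟦ a ⊗ b ⟧ ρ = ⟦ a ⟧ ρ ⊗ₐ ⟦ b ⟧ ρ
  ⟦ a ∘ b ⟧ ρ = ⟦ a ⟧ ρ ∘ₐ ⟦ b ⟧ ρ
  ⟦ a * ⟧   ρ = ⟦ a ⟧ ρ *ₐ

  Hom≈⟦⟧ : (H : Hom alg) → ∀ φ → Hom.h H φ ≈ ⟦ φ ⟧ (λ n → Hom.h H (var n))
  Hom≈⟦⟧ H (var n) = ≈-refl
  Hom≈⟦⟧ H (a ⊗ b) = ≈-trans (Hom.h-⊗ H a b) (⊗-cong (Hom≈⟦⟧ H a) (Hom≈⟦⟧ H b))
  Hom≈⟦⟧ H (a ∘ b) = ≈-trans (Hom.h-∘ H a b) (∘-cong (Hom≈⟦⟧ H a) (Hom≈⟦⟧ H b))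
  Hom≈⟦⟧ H (a *)   = ≈-trans (Hom.h-* H a) (*-cong (Hom≈⟦⟧ H a))

  module _ (ρ : ℕ → Carrier) where

    ⟦⟧-Rep : ⟦ φ ⟧ ρ ≈ ⟦ ψ ⟧ ρ → Rep φ ψ χ χ' → ⟦ χ ⟧ ρ ≈ ⟦ χ' ⟧ ρ
    ⟦⟧-Rep φ≈ψ rep-here    = φ≈ψ
    ⟦⟧-Rep φ≈ψ (rep-var n) = ≈-refl
    ⟦⟧-Rep φ≈ψ (rep-⊗ p q) = ⊗-cong (⟦⟧-Rep φ≈ψ p) (⟦⟧-Rep φ≈ψ q)
    ⟦⟧-Rep φ≈ψ (rep-∘ p q) = ∘-cong (⟦⟧-Rep φ≈ψ p) (⟦⟧-Rep φ≈ψ q)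
    ⟦⟧-Rep φ≈ψ (rep-* p)   = *-cong (⟦⟧-Rep φ≈ψ p)

    Axiom-sound : InClass v M → Axiom v φ → F⟂ (⟦ φ ⟧ ρ)
    Axiom-sound M∈v (A1 _)       = ≈⇒F⟂-⇒ ≈-refl
    Axiom-sound M∈v (A2 _ _)     = ≈⇒F⟂-⇒ (∘-comm _ _)
    Axiom-sound M∈v (A3 _)       = ≈⇒F⟂-⇒ (≈-sym (*-invol _))
    Axiom-sound M∈v (A4 _ _)     = ⟂*⇒F⟂-⇒ (c-f _ _)
    Axiom-sound M∈v (A5 _ _)     = c-e₁ _ _ (≈⇒F⟂-⇒ (⊗-comm _ _)) (≈⇒F⟂-⇒ (⊗-comm _ _))
    Axiom-sound M∈v (A6 _ _ _)   =
      ≈⇒F⟂-⇒ (*-cong (≈-trans (⊗∘-exch _ _ _) (∘-cong ≈-refl (≈-sym (*-invol _)))))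
    Axiom-sound M∈v (A7 _ _ _)   = ⟂*⇒F⟂-⇒ (c-h _ _ _)
    Axiom-sound M∈v (AS1 _ _ _)  = ≈⇒F⟂-⇒ (proj₂ M∈v _ _ _)
    Axiom-sound M∈v (AS2 _ _ _)  = ≈⇒F⟂-⇒ (≈-sym (proj₂ M∈v _ _ _))

    Deriv-sound : InClass v M → (∀ {ψ} → Γ ψ → F⟂ (⟦ ψ ⟧ ρ)) → Deriv v Γ φ → F⟂ (⟦ φ ⟧ ρ)
    Deriv-sound {v = v} {Γ = Γ} M∈v ρ⊨Γ = go
      where
      go : Deriv v Γ φ → F⟂ (⟦ φ ⟧ ρ)
      go (prem p)   = ρ⊨Γ p
      go (ax a)     = Axiom-sound M∈v a
      go (mp d e)   = F⟂-mp (go d) (go e)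
      go (adj d e)  = c-e₁ _ _ (go d) (go e)
      go (eq d e r) = F⟂-resp (⟦⟧-Rep (F⟂-⟺⇒≈ (go d)) (Rep⁺⇒Rep r)) (go e)
      go (ce d)     = proj₁ (c-e₂ _ _ (go d))
      go (di ψ d)   = proj₁ M∈v _ _ (go d)

sound : Deriv v Γ φ → Γ ⊨[ v ] φ
sound {φ = φ} d M M∈v H H⊨Γ =
  F⟂-resp (≈-sym (Hom≈⟦⟧ H φ))
    (Deriv-sound _ M∈v (λ {ψ} p → F⟂-resp (Hom≈⟦⟧ H ψ) (H⊨Γ p)) d)
  where
  open ModelProperties M
  open IsEquivalence (WeakNAlg.isEquivalence (NwModel.alg M)) using () renaming (sym to ≈-sym)

module Lindenbaum (v : Variant) (Γ : FSet) where

  infix 2 _≋_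
  _≋_ : Formula → Formula → Set
  a ≋ b = Deriv v Γ (a ⟺ b)

  Deriv-Rep : φ ≋ ψ → Deriv v Γ χ → Rep φ ψ χ χ' → Deriv v Γ χ'
  Deriv-Rep φ≋ψ d r with Rep⇒≡⊎Rep⁺ r
  ... | inj₁ refl = d
  ... | inj₂ r⁺   = eq φ≋ψ d r⁺

  Deriv-resp : φ ≋ ψ → Deriv v Γ φ → Deriv v Γ ψ
  Deriv-resp φ≋ψ d = eq φ≋ψ d rep⁺-here

  ≋-refl : ∀ a → a ≋ a
  ≋-refl a = adj (ax (A1 a)) (ax (A1 a))

  ≋-sym : ∀ {a b} → a ≋ b → b ≋ a
  ≋-sym {a} {b} a≋b = Deriv-resp (ax (A5 (a ⇒ b) (b ⇒ a))) a≋b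

  ≋-trans : ∀ {a b c} → a ≋ b → b ≋ c → a ≋ c
  ≋-trans {a} a≋b b≋c = Deriv-Rep b≋c a≋b
    (rep-⊗ (rep-* (rep-∘ (Rep-refl a) (rep-* rep-here)))
           (rep-* (rep-∘ rep-here (Rep-refl (a *)))))

  ≋-Rep : φ ≋ ψ → Rep φ ψ χ χ' → χ ≋ χ'
  ≋-Rep {χ = χ} φ≋ψ r = Deriv-Rep φ≋ψ (≋-refl χ)
    (rep-⊗ (rep-* (rep-∘ (Rep-refl χ) (rep-* r)))
           (rep-* (rep-∘ r (Rep-refl (χ *)))))

  ⊗-cong : ∀ {a a' b b'} → a ≋ a' → b ≋ b' → a ⊗ b ≋ a' ⊗ b'
  ⊗-cong {a' = a'} {b} a≋a' b≋b' =
    ≋-trans (≋-Rep a≋a' (rep-⊗ rep-here (Rep-refl b))) (≋-Rep b≋b' (rep-⊗ (Rep-refl a') rep-here))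

  ∘-cong : ∀ {a a' b b'} → a ≋ a' → b ≋ b' → a ∘ b ≋ a' ∘ b'
  ∘-cong {a' = a'} {b} a≋a' b≋b' =
    ≋-trans (≋-Rep a≋a' (rep-∘ rep-here (Rep-refl b))) (≋-Rep b≋b' (rep-∘ (Rep-refl a') rep-here))

  *-cong : ∀ {a a'} → a ≋ a' → a * ≋ a' *
  *-cong a≋a' = ≋-Rep a≋a' (rep-* rep-here)

  ⇒-cong : ∀ {a a' b b'} → a ≋ a' → b ≋ b' → (a ⇒ b) ≋ (a' ⇒ b')
  ⇒-cong a≋a' b≋b' = *-cong (∘-cong a≋a' (*-cong b≋b'))

  ∘-comm : ∀ a b → a ∘ b ≋ b ∘ a
  ∘-comm a b = adj (ax (A2 a b)) (ax (A2 b a))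

  ⊗-comm : ∀ a b → a ⊗ b ≋ b ⊗ a
  ⊗-comm a b = ax (A5 a b)

  *-invol : ∀ a → a * * ≋ a
  *-invol a = adj (Deriv-resp (*-cong (∘-comm (a *) (a * *))) (ax (A1 (a *)))) (ax (A3 a))

  ⇒-contrapose : ∀ a b → (a ⇒ b) ≋ (b * ⇒ a *)
  ⇒-contrapose a b = *-cong (≋-trans (∘-comm a (b *)) (∘-cong (≋-refl (b *)) (≋-sym (*-invol a))))

  -- (A6) with χ := y* is the contrapositive of this implication.
  ⊗∘-exch⇒ : ∀ x y z → Deriv v Γ (((x ⊗ y) ∘ z) ⇒ ((x ⊗ z) ∘ y))
  ⊗∘-exch⇒ x y z = Deriv-resp
    (≋-trans (⇒-contrapose _ _)
             (⇒-cong (≋-trans (*-invol _) (∘-cong (⊗-cong (≋-refl x) (*-invol y)) (*-invol z)))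
                     (≋-trans (*-invol _) (∘-cong (≋-refl (x ⊗ z)) (*-invol y)))))
    (ax (A6 x z (y *)))

  ⊗∘-exch : ∀ x y z → (x ⊗ y) ∘ z ≋ (x ⊗ z) ∘ y
  ⊗∘-exch x y z = adj (⊗∘-exch⇒ x y z) (⊗∘-exch⇒ x z y)

  algebra : WeakNAlg
  algebra = record
    { Carrier = Formula ; _≈_ = _≋_
    ; isEquivalence = record { refl = ≋-refl _ ; sym = ≋-sym ; trans = ≋-trans }
    ; _⊗ₐ_ = _⊗_ ; _∘ₐ_ = _∘_ ; _*ₐ = _*
    ; ⊗-cong = ⊗-cong ; ∘-cong = ∘-cong ; *-cong = *-cong
    ; ⊗-comm = ⊗-comm ; ∘-comm = ∘-comm ; *-invol = *-invol ; ⊗∘-exch = ⊗∘-exch }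

  _⟂_ : Ext Formula → Ext Formula → Set
  el x ⟂ el y = Deriv v Γ ((x ∘ y) *)
  el x ⟂ t    = Deriv v Γ (x *)
  el x ⟂ f    = Deriv v Γ x
  t    ⟂ _    = ⊥
  f    ⟂ _    = ⊥

  ⟂-resp : ∀ {a b c d} → ExtEq _≋_ a c → ExtEq _≋_ b d → a ⟂ b → c ⟂ d
  ⟂-resp (el≈ x≋x') (el≈ y≋y') = Deriv-resp (*-cong (∘-cong x≋x' y≋y'))
  ⟂-resp (el≈ x≋x') t≈         = Deriv-resp (*-cong x≋x')
  ⟂-resp (el≈ x≋x') f≈         = Deriv-resp x≋x'

  model : NwModel
  model = record
    { alg = algebra ; _⟂_ = _⟂_ ; ⟂-resp = ⟂-resp
    ; c-a = λ x → ax (A1 x)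
    ; c-b = λ x y → adj
    ; c-c₁ = λ x y d → d ; c-c₂ = λ x y d → d
    ; c-d₁ = λ x d → d ; c-d₂ = λ x d → d
    ; c-e₁ = λ x y → adj
    ; c-e₂ = λ x y d → ce d , ce (Deriv-resp (⊗-comm x y) d)
    ; c-f = λ x y → ax (A4 x y)
    ; c-g = λ x y x⟂y x⟂f → mp (Deriv-resp (*-cong (∘-cong (≋-refl x) (≋-sym (*-invol y)))) x⟂y) x⟂f
    ; c-h = λ x y z → ax (A7 x y z) }

  identity : Hom algebra
  identity = record { h = λ φ → φ ; h-⊗ = λ _ _ → ≋-refl _ ; h-∘ = λ _ _ → ≋-refl _ ; h-* = λ _ → ≋-refl _ }

Lindenbaum-InClass : ∀ v Γ → InClass v (Lindenbaum.model v Γ)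
Lindenbaum-InClass weak  Γ = (λ _ ψ → di ψ) , tt
Lindenbaum-InClass assoc Γ = (λ _ ψ → di ψ) , λ x y z → adj (ax (AS1 x y z)) (ax (AS2 x y z))

complete : Γ ⊨[ v ] φ → Deriv v Γ φ
complete {Γ} {v} Γ⊨φ = Γ⊨φ model (Lindenbaum-InClass v Γ) identity prem
  where open Lindenbaum v Γ

Deriv⇔Consequence : ∀ v Γ φ → Deriv v Γ φ ⇔ Consequence v Γ φ
Deriv⇔Consequence v Γ φ = mk⇔ to from
  where
  to : Deriv v Γ φ → Consequence v Γ φ
  to d with Deriv-compact d
  ... | Γ' , Γ'⊆Γ , d' = Γ' , Γ'⊆Γ , λ M M∈v H H⊨Γ' → sound d' M M∈v H (All.lookup H⊨Γ')

  from : Consequence v Γ φ → Deriv v Γ φ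
  from (Γ' , Γ'⊆Γ , Γ'⊨φ) =
    Deriv-mono (All.lookup Γ'⊆Γ) (complete λ M M∈v H H⊨Γ' → Γ'⊨φ M M∈v H (All.tabulate H⊨Γ'))

Thm⇔Valid : ∀ v φ → Thm v φ ⇔ Valid v φ
Thm⇔Valid v φ = mk⇔
  (λ ⊢φ M M∈v H → sound (Thm⇒Deriv∅ ⊢φ) M M∈v H λ ())
  (λ ⊨φ → Deriv∅⇒Thm (complete λ M M∈v H _ → ⊨φ M M∈v H))

theorem5p11 : (∀ (Γ : FSet) (φ : Formula) → Deriv weak Γ φ ⇔ Consequence weak Γ φ)
    × (∀ (Γ : FSet) (φ : Formula) → Deriv assoc Γ φ ⇔ Consequence assoc Γ φ)
    × (∀ (φ : Formula) → Thm weak φ ⇔ Valid weak φ)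
    × (∀ (φ : Formula) → Thm assoc φ ⇔ Valid assoc φ)
theorem5p11 = Deriv⇔Consequence weak , Deriv⇔Consequence assoc , Thm⇔Valid weak , Thm⇔Valid assoc
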